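{- There is a register machine (addition machine) with four integer registers which, on input of integers $y$ and $z$ with $z\neq 0$, outputs $\lfloor y/z\rfloor$ and executes $O(m)$ steps, where $m$ is the smallest natural number such that $2^m\cdot|z|\geq |y|$.
   Context: Model (addition machine): a program is a finite list of numbered lines; the machine has finitely many registers, each holding an arbitrary integer. Allowed commands, each counting as one step, are: $x=y+z$, $x=y+k$, $x=y-z$, $x=y-k$, $x=k-y$, $x=k$ (for registers $x,y,z$, not necessarily distinct, and integer constants $k$); "read $x$" (reads one whole integer input into a register) and "write $x$" (outputs the whole content of a register); "if $x\,R\,y$ then ... else ..." and "if $x\,R\,k$ then ... else ..." with $R\in\{<,=,>,\neq,\leq,\geq\}$; and "goto $\ell$" for a fixed line number $\ell$. In addition the program may use finitely many variables with a fixed finite range of values; these do not count as registers. The number of registers of a machine is the number of integer registers it uses; running time is the number of executed commands. -}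

module Defs where

open import Data.Nat as ℕ using (ℕ; zero; suc; _^_)
open import Data.Integer as ℤ using (ℤ; +_; -[1+_]; ∣_∣)
open import Data.Rational as ℚ using (ℚ; floor)
open import Data.Fin using (Fin)
open import Data.Bool using (Bool; true; false; if_then_else_)
open import Data.List using (List; []; _∷_; _++_; [_])
open import Data.Maybe using (Maybe; just; nothing)
open import Data.Product using (_×_; _,_)
open import Relation.Nullary using (does)
open import Relation.Binary.PropositionalEquality using (_≡_)

-- Addition machines.
--   r  : number of integer registers (registers are Fin r)
--   nv : number of finite-range auxiliary variables (Fin nv)
--   b  : each auxiliary variable ranges over Fin (suc b)
-- Auxiliary variables are not registers.

data Rel : Set where
  lt eq gt ne le ge : Rel

holds : Rel → ℤ → ℤ → Bool
holds lt a b = does (a ℤ.<? b)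
holds eq a b = does (a ℤ.≟ b)
holds gt a b = does (b ℤ.<? a)
holds ne a b = Data.Bool.not (does (a ℤ.≟ b))
holds le a b = does (a ℤ.≤? b)
holds ge a b = does (b ℤ.≤? a)

data Cmd (r nv b : ℕ) : Set where
  addR  : (x y z : Fin r) → Cmd r nv b
  addK  : (x y : Fin r) (k : ℤ) → Cmd r nv b
  subR  : (x y z : Fin r) → Cmd r nv b
  subK  : (x y : Fin r) (k : ℤ) → Cmd r nv b
  kSub  : (x : Fin r) (k : ℤ) (y : Fin r) → Cmd r nv b
  setK  : (x : Fin r) (k : ℤ) → Cmd r nv b
  read  : (x : Fin r) → Cmd r nv b
  write : (x : Fin r) → Cmd r nv b
  ifR   : Rel → (x y : Fin r) → (c₁ c₂ : Cmd r nv b) → Cmd r nv b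
  ifK   : Rel → (x : Fin r) (k : ℤ) → (c₁ c₂ : Cmd r nv b) → Cmd r nv b
  goto  : (ℓ : ℕ) → Cmd r nv b
  setV  : (v : Fin nv) (j : Fin (suc b)) → Cmd r nv b
  ifV   : (v : Fin nv) (j : Fin (suc b)) → (c₁ c₂ : Cmd r nv b) → Cmd r nv b

-- a program: lines numbered 0,1,2,... ; the machine halts when control
-- reaches a line number that does not exist
Program : ℕ → ℕ → ℕ → Set
Program r nv b = List (Cmd r nv b)

record Store (r nv b : ℕ) : Set where
  constructor store
  field
    regs   : Fin r → ℤ
    vars   : Fin nv → Fin (suc b)
    input  : List ℤ
    output : List ℤ
open Store

upd : ∀ {n} {A : Set} → (Fin n → A) → Fin n → A → Fin n → A
upd f i a j = if does (i Data.Fin.≟ j) then a else f j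

setReg : ∀ {r nv b} → Store r nv b → Fin r → ℤ → Store r nv b
setReg s x a = store (upd (regs s) x a) (vars s) (input s) (output s)

-- executing one command: either a crash (nothing, reading from exhausted
-- input), or an optional jump target, the new store and the number of
-- commands executed (an 'if' plus the executed branch command).
branch : ∀ {r nv b} → Bool → Cmd r nv b → Cmd r nv b → Store r nv b → Maybe (Maybe ℕ × Store r nv b × ℕ)
addStep : ∀ {r nv b} → Maybe (Maybe ℕ × Store r nv b × ℕ) → Maybe (Maybe ℕ × Store r nv b × ℕ)
exec : ∀ {r nv b} → Cmd r nv b → Store r nv b → Maybe (Maybe ℕ × Store r nv b × ℕ)
exec (addR x y z) s = just (nothing , setReg s x (regs s y ℤ.+ regs s z) , 1)
exec (addK x y k) s = just (nothing , setReg s x (regs s y ℤ.+ k) , 1)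
exec (subR x y z) s = just (nothing , setReg s x (regs s y ℤ.- regs s z) , 1)
exec (subK x y k) s = just (nothing , setReg s x (regs s y ℤ.- k) , 1)
exec (kSub x k y) s = just (nothing , setReg s x (k ℤ.- regs s y) , 1)
exec (setK x k)   s = just (nothing , setReg s x k , 1)
exec (read x) (store g v [] o) = nothing
exec (read x) (store g v (a ∷ i) o) = just (nothing , store (upd g x a) v i o , 1)
exec (write x) s = just (nothing , store (regs s) (vars s) (input s) (output s ++ [ regs s x ]) , 1)
exec (ifR R x y c₁ c₂) s = branch (holds R (regs s x) (regs s y)) c₁ c₂ s
exec (ifK R x k c₁ c₂) s = branch (holds R (regs s x) k) c₁ c₂ s
exec (goto ℓ) s = just (just ℓ , s , 1)
exec (setV v j) s = just (nothing , store (regs s) (upd (vars s) v j) (input s) (output s) , 1)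
exec (ifV v j c₁ c₂) s = branch (does (vars s v Data.Fin.≟ j)) c₁ c₂ s

branch true  c₁ c₂ s = addStep (exec c₁ s)
branch false c₁ c₂ s = addStep (exec c₂ s)

addStep nothing = nothing
addStep (just (j , s' , n)) = just (j , s' , suc n)

lineAt : ∀ {A : Set} → List A → ℕ → Maybe A
lineAt [] _ = nothing
lineAt (c ∷ cs) zero = just c
lineAt (c ∷ cs) (suc n) = lineAt cs n

nextLine : ℕ → Maybe ℕ → ℕ
nextLine pc nothing = suc pc
nextLine pc (just ℓ) = ℓ

-- Runs P pc s t out : started at line pc with store s, the machine halts
-- after executing exactly t commands, with total output out.
data Runs {r nv b : ℕ} (P : Program r nv b) : ℕ → Store r nv b → ℕ → List ℤ → Set where
  halt : ∀ {pc s} → lineAt P pc ≡ nothing → Runs P pc s 0 (output s)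
  step : ∀ {pc s c j s' n t out} →
         lineAt P pc ≡ just c → exec c s ≡ just (j , s' , n) →
         Runs P (nextLine pc j) s' t out → Runs P pc s (n ℕ.+ t) out

initStore : ∀ {r nv b} → List ℤ → Store r nv b
initStore i = store (λ _ → + 0) (λ _ → Data.Fin.zero) i []

RunsOn : ∀ {r nv b} → Program r nv b → List ℤ → ℕ → List ℤ → Set
RunsOn P i t out = Runs P 0 (initStore i) t out

-- ⌊ y / z ⌋ : floor of the rational number y / z (value for z = 0 irrelevant)
floorDiv : ℤ → ℤ → ℤ
floorDiv y (+ zero)  = + 0
floorDiv y (+ suc n) = floor (y ℚ./ suc n)
floorDiv y -[1+ n ]  = floor ((ℤ.- y) ℚ./ suc n)

IsLeastExp : ℤ → ℤ → ℕ → Set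
IsLeastExp y z m = (∣ y ∣ ℕ.≤ 2 ^ m ℕ.* ∣ z ∣) × (∀ k → k ℕ.< m → ¬' (∣ y ∣ ℕ.≤ 2 ^ k ℕ.* ∣ z ∣))
  where
  open import Relation.Nullary using () renaming (¬_ to ¬')

{-# OPTIONS --safe #-}
-- The machine replaces y and z by a = |y| and b = |z|, remembering the sign of y / z in a flag.
-- It doubles b until 2^k·b > a, which takes k ≤ m + 1 rounds, and then runs k rounds of binary
-- long division of 2^k·a by 2^k·b, keeping 2^c·(q·2^k·b + r) constant while c counts the rounds
-- still to go. This yields a = q·b + s with the final remainder equal to 2^k·s, so it vanishes
-- exactly when s does; that decides whether ⌊−a/b⌋ is −q or −(q + 1). Each round costs a bounded
-- number of steps, so the run is linear in m.
module Submission where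

open import Data.Empty using (⊥-elim)
open import Data.Fin using (Fin; zero; suc; _≟_)
open import Data.Integer as ℤ using (ℤ; +_; -[1+_]; ∣_∣)
open import Data.Integer.DivMod using (a≡a%n+[a/n]*n; n%d<d)
import Data.Integer.Properties as ℤP
open import Data.Integer.Solver using (module +-*-Solver)
open import Data.List using ([]; _∷_; _++_)
open import Data.Maybe using (just)
open import Data.Nat as ℕ using (ℕ; zero; suc; _≤_; _<_; _+_; _*_; _∸_; _^_; _≤?_; _<?_; z<s)
import Data.Nat.GCD as ℕG
import Data.Nat.Properties as ℕP
open import Data.Nat.Solver using () renaming (module +-*-Solver to ℕ-Solver)
open import Data.Product using (Σ; _×_; _,_)
open import Data.Rational as ℚ using (floor)
import Data.Rational.Properties as ℚP
open import Data.Sum using (inj₁; inj₂)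
open import Relation.Binary.PropositionalEquality
open import Relation.Nullary using (does; yes; no; contradiction)
open import Relation.Nullary.Decidable using (dec-true; dec-false)

open import Defs

quotient-≤ : ∀ n {q q′ Y : ℤ} → q ℤ.* + suc n ℤ.≤ Y → Y ℤ.< q′ ℤ.* + suc n ℤ.+ + suc n → q ℤ.≤ q′
quotient-≤ n {q} {q′} {Y} qb≤Y Y<q′b+b with q ℤ.≤? q′
... | yes q≤q′ = q≤q′
... | no q≰q′ = contradiction (ℤP.≤-trans q′b+b≤qb qb≤Y) (ℤP.<⇒≱ Y<q′b+b)
  where
  b = + suc n
  q′b+b≤qb : q′ ℤ.* b ℤ.+ b ℤ.≤ q ℤ.* b
  q′b+b≤qb = subst (ℤ._≤ q ℤ.* b) (trans (ℤP.suc-* q′ b) (ℤP.+-comm b (q′ ℤ.* b)))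
               (ℤP.*-monoʳ-≤-nonNeg b (ℤP.i<j⇒suc[i]≤j (ℤP.≰⇒> q≰q′)))

floor-/-divMod : ∀ Y n → Σ ℕ λ ρ → ρ < suc n × Y ≡ + ρ ℤ.+ floor (Y ℚ./ suc n) ℤ.* + suc n
floor-/-divMod Y n = ρ * g , ρg<b , Y≡
  where
  open +-*-Solver
  p = Y ℚ./ suc n
  g = ℕG.gcd ∣ Y ∣ (suc n)
  ρ = ℚ.↥ p ℤ.% ℚ.↧ p
  instance
    g≢0 : ℕ.NonZero g
    g≢0 = ℕ.≢-nonZero (ℕG.gcd[m,n]≢0 ∣ Y ∣ (suc n) (inj₂ λ ()))
  ↥≡%+floor* : ∀ x → ℚ.↥ x ≡ + (ℚ.↥ x ℤ.% ℚ.↧ x) ℤ.+ floor x ℤ.* ℚ.↧ x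
  ↥≡%+floor* x@record{} = a≡a%n+[a/n]*n (ℚ.↥ x) (ℚ.↧ x)
  ρg<b : ρ * g < suc n
  ρg<b = subst (ρ * g <_) (trans (sym (ℤP.abs-* (ℚ.↧ p) (+ g))) (cong ∣_∣ (ℚP.↧-/ Y (suc n))))
           (ℕP.*-monoˡ-< g (n%d<d (ℚ.↥ p) (ℚ.↧ p)))
  Y≡ : Y ≡ + (ρ * g) ℤ.+ floor p ℤ.* + suc n
  Y≡ = begin
    Y
      ≡⟨ ℚP.↥-/ Y (suc n) ⟨
    ℚ.↥ p ℤ.* + g
      ≡⟨ cong (ℤ._* + g) (↥≡%+floor* p) ⟩
    (+ ρ ℤ.+ floor p ℤ.* ℚ.↧ p) ℤ.* + g
      ≡⟨ solve 4 (λ r f d g → (r :+ f :* d) :* g := r :* g :+ f :* (d :* g)) refl (+ ρ) (floor p) (ℚ.↧ p) (+ g) ⟩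
    + ρ ℤ.* + g ℤ.+ floor p ℤ.* (ℚ.↧ p ℤ.* + g)
      ≡⟨ cong₂ ℤ._+_ (sym (ℤP.pos-* ρ g)) (cong (floor p ℤ.*_) (ℚP.↧-/ Y (suc n))) ⟩
    + (ρ * g) ℤ.+ floor p ℤ.* + suc n ∎
    where open ≡-Reasoning

floor-/-unique : ∀ n Y {q : ℤ} → q ℤ.* + suc n ℤ.≤ Y → Y ℤ.< q ℤ.* + suc n ℤ.+ + suc n →
                 floor (Y ℚ./ suc n) ≡ q
floor-/-unique n Y {q} qb≤Y Y<qb+b with floor-/-divMod Y n
... | ρ , ρ<b , Y≡ρ+fb = ℤP.≤-antisym (quotient-≤ n fb≤Y Y<qb+b) (quotient-≤ n qb≤Y Y<fb+b)
  where
  fb = floor (Y ℚ./ suc n) ℤ.* + suc n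
  fb≤Y : fb ℤ.≤ Y
  fb≤Y = subst (fb ℤ.≤_) (sym Y≡ρ+fb) (ℤP.i≤j+i fb (+ ρ))
  Y<fb+b : Y ℤ.< fb ℤ.+ + suc n
  Y<fb+b = subst₂ ℤ._<_ (sym Y≡ρ+fb) (ℤP.+-comm (+ suc n) fb) (ℤP.+-monoˡ-< fb (ℤ.+<+ ρ<b))

i<i+[1+n] : ∀ i n → i ℤ.< i ℤ.+ + suc n
i<i+[1+n] i n = subst (ℤ._< i ℤ.+ + suc n) (ℤP.+-identityʳ i) (ℤP.+-monoʳ-< i (ℤ.+<+ z<s))

module _ (n q : ℕ) where
  private
    b = suc n

    -q*b : ∀ m → ℤ.- + m ℤ.* + b ≡ ℤ.- + (m * b)
    -q*b m = trans (sym (ℤP.neg-distribˡ-* (+ m) (+ b))) (cong ℤ.-_ (sym (ℤP.pos-* m b)))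

  floor-+-divMod : ∀ s → s < b → floor (+ (q * b + s) ℚ./ b) ≡ + q
  floor-+-divMod s s<b = floor-/-unique n (+ (q * b + s))
    (subst (ℤ._≤ + (q * b + s)) (ℤP.pos-* q b) (ℤ.+≤+ (ℕP.m≤m+n (q * b) s)))
    (subst (+ (q * b + s) ℤ.<_) (cong (ℤ._+ + b) (ℤP.pos-* q b)) (ℤ.+<+ (ℕP.+-monoʳ-< (q * b) s<b)))

  floor-neg-divMod-0 : floor (ℤ.- + (q * b + 0) ℚ./ b) ≡ ℤ.- + q
  floor-neg-divMod-0 = floor-/-unique n Y (ℤP.≤-reflexive -qb≡Y)
    (subst (λ x → Y ℤ.< x ℤ.+ + b) (sym -qb≡Y) (i<i+[1+n] Y n))
    where
    Y = ℤ.- + (q * b + 0)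
    -qb≡Y : ℤ.- + q ℤ.* + b ≡ Y
    -qb≡Y = trans (-q*b q) (cong (λ x → ℤ.- + x) (sym (ℕP.+-identityʳ _)))

  floor-neg-divMod-suc : ∀ s → suc s < b → floor (ℤ.- + (q * b + suc s) ℚ./ b) ≡ ℤ.- + (q + 1)
  floor-neg-divMod-suc s s<b = floor-/-unique n Y
    (subst (ℤ._≤ Y) (sym (-q*b (q + 1)))
      (ℤP.neg-mono-≤ (ℤ.+≤+ (subst (q * b + suc s ≤_) (sym [q+1]b) (ℕP.+-monoʳ-≤ (q * b) (ℕP.<⇒≤ s<b))))))
    (subst (Y ℤ.<_) (sym -[q+1]b+b≡-qb) (ℤP.neg-mono-< (ℤ.+<+ (ℕP.m<m+n (q * b) z<s))))
    where
    open +-*-Solver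
    Y = ℤ.- + (q * b + suc s)
    [q+1]b : (q + 1) * b ≡ q * b + b
    [q+1]b = trans (ℕP.*-distribʳ-+ b q 1) (cong (λ x → q * b + x) (ℕP.*-identityˡ b))
    -[q+1]b+b≡-qb : ℤ.- + (q + 1) ℤ.* + b ℤ.+ + b ≡ ℤ.- + (q * b)
    -[q+1]b+b≡-qb = begin
      ℤ.- + (q + 1) ℤ.* + b ℤ.+ + b    ≡⟨ cong (λ x → x ℤ.+ + b) (-q*b (q + 1)) ⟩
      ℤ.- + ((q + 1) * b) ℤ.+ + b    ≡⟨ cong (λ x → ℤ.- + x ℤ.+ + b) [q+1]b ⟩
      ℤ.- (+ (q * b) ℤ.+ + b) ℤ.+ + b  ≡⟨ solve 2 (λ x y → :- (x :+ y) :+ y := :- x) refl (+ (q * b)) (+ b) ⟩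
      ℤ.- + (q * b)                    ∎
      where open ≡-Reasoning

scaled-divMod : ∀ c .{{_ : ℕ.NonZero c}} a b q r → c * a ≡ q * (c * b) + r → r < c * b →
                Σ ℕ λ s → a ≡ q * b + s × s < b × r ≡ c * s
scaled-divMod c a b q r ca≡q[cb]+r r<cb = s , a≡qb+s , s<b , r≡cs
  where
  open ℕ-Solver
  ca≡c[qb]+r : c * a ≡ c * (q * b) + r
  ca≡c[qb]+r = trans ca≡q[cb]+r (cong (_+ r) (solve 3 (λ q c b → q :* (c :* b) := c :* (q :* b)) refl q c b))
  qb≤a : q * b ≤ a
  qb≤a = ℕP.*-cancelˡ-≤ c (subst (c * (q * b) ≤_) (sym ca≡c[qb]+r) (ℕP.m≤m+n _ r))
  s = a ∸ q * b
  a≡qb+s : a ≡ q * b + s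
  a≡qb+s = sym (ℕP.m+[n∸m]≡n qb≤a)
  r≡cs : r ≡ c * s
  r≡cs = ℕP.+-cancelˡ-≡ (c * (q * b)) r (c * s)
           (trans (sym ca≡c[qb]+r) (trans (cong (c *_) a≡qb+s) (ℕP.*-distribˡ-+ c (q * b) s)))
  s<b : s < b
  s<b = ℕP.*-cancelˡ-< c s b (subst (_< c * b) r≡cs r<cb)

2^[1+m]*b : ∀ m b → 2 ^ m * b + 2 ^ m * b ≡ 2 ^ suc m * b
2^[1+m]*b m b = solve 2 (λ x y → x :* y :+ x :* y := (con 2 :* x) :* y) refl (2 ^ m) b
  where open ℕ-Solver

2^m*b<2^[1+m]*b : ∀ m b → 0 < b → 2 ^ m * b < 2 ^ suc m * b
2^m*b<2^[1+m]*b m b b>0 = subst (2 ^ m * b <_) (2^[1+m]*b m b) (ℕP.m<m+n (2 ^ m * b) 0<2^m*b)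
  where
  0<2^m*b : 0 < 2 ^ m * b
  0<2^m*b = ℕP.≤-trans b>0 (ℕP.m≤n*m b (2 ^ m) {{ℕP.m^n≢0 2 m}})

doublings≤1+m : ∀ a b m k → 0 < b → a ≤ 2 ^ m * b → (∀ i → i < k → 2 ^ i * b ≤ a) → k ≤ suc m
doublings≤1+m a b m k b>0 a≤2^mb below with k ≤? suc m
... | yes k≤1+m = k≤1+m
... | no k≰1+m = contradiction (ℕP.≤-trans (below (suc m) (ℕP.≰⇒> k≰1+m)) a≤2^mb)
                               (ℕP.<⇒≱ (2^m*b<2^[1+m]*b m b b>0))

module Execution {r nv b : ℕ} (P : Program r nv b) where

  data Reach : ℕ → Store r nv b → ℕ → Store r nv b → ℕ → Set where
    done : ∀ {pc s} → Reach pc s pc s 0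
    step : ∀ {pc s c j s′ n pc″ s″ t} → lineAt P pc ≡ just c → exec c s ≡ just (j , s′ , n) →
           Reach (nextLine pc j) s′ pc″ s″ t → Reach pc s pc″ s″ (n + t)

  runs-after : ∀ {pc s pc′ s′ n t out} → Reach pc s pc′ s′ n → Runs P pc′ s′ t out → Runs P pc s (n + t) out
  runs-after done run = run
  runs-after {pc} {s} {out = out} (step {n = n} {t = t} line ex reach) run =
    subst (λ u → Runs P pc s u out) (sym (ℕP.+-assoc n t _)) (step line ex (runs-after reach run))

  step-if : ∀ {pc c c₁ c₂ s β β′ j s′ n pc″ s″ t} → lineAt P pc ≡ just c → exec c s ≡ branch β c₁ c₂ s →
            β ≡ β′ → branch β′ c₁ c₂ s ≡ just (j , s′ , n) →
            Reach (nextLine pc j) s′ pc″ s″ t → Reach pc s pc″ s″ (n + t)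
  step-if {c₁ = c₁} {c₂} {s} line ex β≡β′ ex′ =
    step line (trans ex (trans (cong (λ β → branch β c₁ c₂ s) β≡β′) ex′))

R D Q K : Fin 4
R = zero
D = suc zero
Q = suc (suc zero)
K = suc (suc (suc zero))

negative : Fin 1
negative = zero

-- Lines 0–5 replace y, z by |y|, |z| in R, D and set the flag when y / z < 0; lines 6–8 double D
-- until D > R, counting in K; lines 9–14 are binary long division of 2^K · R by D, developing the
-- quotient in Q; lines 15–17 turn the quotient of the absolute values into the floor of y / z.
divider : Program 4 1 1
divider =
  read R ∷ read D ∷ ifK ge D (+ 0) (goto 4) (kSub D (+ 0) D) ∷ kSub R (+ 0) R ∷
  ifK ge R (+ 0) (goto 6) (kSub R (+ 0) R) ∷ setV negative (suc zero) ∷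
  ifR gt D R (goto 9) (addR D D D) ∷ addK K K (+ 1) ∷ goto 6 ∷
  ifK eq K (+ 0) (goto 15) (subK K K (+ 1)) ∷ addR R R R ∷ addR Q Q Q ∷
  ifR lt R D (goto 9) (subR R R D) ∷ addK Q Q (+ 1) ∷ goto 9 ∷
  ifV negative zero (goto 18) (goto 16) ∷ ifK eq R (+ 0) (goto 17) (addK Q Q (+ 1)) ∷
  kSub Q (+ 0) Q ∷ write Q ∷ []

St : Set
St = Store 4 1 1

open Store
open Execution divider

record Holds (s : St) (r d q k : ℕ) (σ : Fin 2) : Set where
  constructor holding
  field
    R≡ : regs s R ≡ + r
    D≡ : regs s D ≡ + d
    Q≡ : regs s Q ≡ + q
    K≡ : regs s K ≡ + k
    flag≡ : vars s negative ≡ σ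
    no-output : output s ≡ []
open Holds

module _ {s : St} {r d q k : ℕ} {σ : Fin 2} (H : Holds s r d q k σ) where

  D>R-test : holds gt (regs s D) (regs s R) ≡ does (r <? d)
  D>R-test = cong₂ (holds gt) (D≡ H) (R≡ H)

  K=0-test : holds eq (regs s K) (+ 0) ≡ holds eq (+ k) (+ 0)
  K=0-test = cong (λ v → holds eq v (+ 0)) (K≡ H)

  R+R<D-test : holds lt (regs s R ℤ.+ regs s R) (regs s D) ≡ does (r + r <? d)
  R+R<D-test = cong₂ (holds lt) (cong₂ ℤ._+_ (R≡ H) (R≡ H)) (D≡ H)

  flag-test : does (vars s negative ≟ zero) ≡ does (σ ≟ zero)
  flag-test = cong (λ v → does (v ≟ zero)) (flag≡ H)

  R=0-test : holds eq (regs s R) (+ 0) ≡ holds eq (+ r) (+ 0)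
  R=0-test = cong (λ v → holds eq v (+ 0)) (R≡ H)

signed : Fin 2 → ℕ → ℤ
signed zero a = + a
signed (suc zero) a = ℤ.- + a

record Normalised (y z : ℤ) : Set where
  constructor normalised
  field
    a n : ℕ
    σ : Fin 2
    s : St
    t : ℕ
    run : Reach 0 (initStore (y ∷ z ∷ [])) 6 s t
    registers : Holds s a (suc n) 0 0 σ
    time : t ≤ 8
    ∣y∣≡a : ∣ y ∣ ≡ a
    ∣z∣≡1+n : ∣ z ∣ ≡ suc n
    floorDiv≡ : floorDiv y z ≡ floor (signed σ a ℚ./ suc n)

-- On the concrete initial store every command, tests included, evaluates by computation.
normalise : ∀ y z → z ≢ + 0 → Normalised y z
normalise y (+ zero) z≢0 = ⊥-elim (z≢0 refl)
normalise (+ a) (+ suc n) _ = normalised a n zero _ _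
  (step refl refl (step refl refl (step refl refl (step refl refl done))))
  (holding refl refl refl refl refl refl) (ℕP.m≤m+n 6 2) refl refl refl
normalise -[1+ a ] (+ suc n) _ = normalised (suc a) n (suc zero) _ _
  (step refl refl (step refl refl (step refl refl (step refl refl (step refl refl done)))))
  (holding refl refl refl refl refl refl) (ℕP.m≤m+n 7 1) refl refl refl
normalise (+ zero) -[1+ n ] _ = normalised 0 n zero _ _
  (step refl refl (step refl refl (step refl refl (step refl refl (step refl refl done)))))
  (holding refl refl refl refl refl refl) (ℕP.m≤m+n 7 1) refl refl refl
normalise (+ suc a) -[1+ n ] _ = normalised (suc a) n (suc zero) _ _
  (step refl refl (step refl refl (step refl refl (step refl refl (step refl refl (step refl refl done))))))
  (holding refl refl refl refl refl refl) ℕP.≤-refl refl refl refl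
normalise -[1+ a ] -[1+ n ] _ = normalised (suc a) n zero _ _
  (step refl refl (step refl refl (step refl refl (step refl refl (step refl refl done)))))
  (holding refl refl refl refl refl refl) (ℕP.m≤m+n 7 1) refl refl refl

module Doubling (a b : ℕ) (σ : Fin 2) (b>0 : 0 < b) where

  record Doubled (s : St) (j : ℕ) : Set where
    constructor doubled
    field
      k : ℕ
      s′ : St
      t : ℕ
      run : Reach 6 s 9 s′ t
      registers : Holds s′ a (2 ^ k * b) 0 k σ
      a<2^kb : a < 2 ^ k * b
      below : ∀ i → i < k → 2 ^ i * b ≤ a
      -- t = 4 (k − j) + 2, stated without truncated subtraction
      time : 4 * j + t ≡ 4 * k + 2

  loop : ∀ fuel j s → Holds s a (2 ^ j * b) 0 j σ → (∀ i → i < j → 2 ^ i * b ≤ a) →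
         a < 2 ^ j * b + fuel → Doubled s j
  loop fuel j s H below bound with a <? 2 ^ j * b
  ... | yes a<2^jb =
    doubled j s 2 (step-if refl refl (trans (D>R-test H) (dec-true (a <? 2 ^ j * b) a<2^jb)) refl done)
            H a<2^jb below refl
  loop zero j s H below bound | no a≮2^jb = contradiction (subst (a <_) (ℕP.+-identityʳ _) bound) a≮2^jb
  loop (suc fuel) j s H below bound | no a≮2^jb = prepend (loop fuel (suc j) s′ H′ below′ bound′)
    where
    s′ : St
    s′ = setReg (setReg s D (regs s D ℤ.+ regs s D)) K (regs s K ℤ.+ + 1)
    H′ : Holds s′ a (2 ^ suc j * b) 0 (suc j) σ
    H′ = holding (R≡ H) (trans (cong₂ ℤ._+_ (D≡ H) (D≡ H)) (cong +_ (2^[1+m]*b j b))) (Q≡ H)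
                 (trans (cong (ℤ._+ + 1) (K≡ H)) (cong +_ (ℕP.+-comm j 1))) (flag≡ H) (no-output H)
    below′ : ∀ i → i < suc j → 2 ^ i * b ≤ a
    below′ i i<1+j with ℕP.m≤n⇒m<n∨m≡n (ℕP.≤-pred i<1+j)
    ... | inj₁ i<j = below i i<j
    ... | inj₂ refl = ℕP.≮⇒≥ a≮2^jb
    bound′ : a < 2 ^ suc j * b + fuel
    bound′ = ℕP.<-≤-trans bound (subst (_≤ 2 ^ suc j * b + fuel) (sym (ℕP.+-suc (2 ^ j * b) fuel))
               (ℕP.+-monoˡ-≤ fuel (2^m*b<2^[1+m]*b j b b>0)))
    prepend : Doubled s′ (suc j) → Doubled s j
    prepend (doubled k s″ t run H″ a<2^kb below″ time) =
      doubled k s″ (2 + (1 + (1 + t))) (step-if refl refl (trans (D>R-test H) (dec-false (a <? 2 ^ j * b) a≮2^jb)) refl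
                                          (step refl refl (step refl refl run)))
              H″ a<2^kb below″
              (trans (solve 2 (λ j t → con 4 :* j :+ (con 4 :+ t) := con 4 :* (con 1 :+ j) :+ t) refl j t) time)
      where open ℕ-Solver

  doubling : ∀ s → Holds s a b 0 0 σ → Doubled s 0
  doubling s H = loop (suc a) 0 s H′ (λ _ ()) (ℕP.<-≤-trans (ℕP.n<1+n a) (ℕP.m≤n+m (suc a) (2 ^ 0 * b)))
    where
    H′ : Holds s a (2 ^ 0 * b) 0 0 σ
    H′ = holding (R≡ H) (trans (D≡ H) (cong +_ (sym (ℕP.*-identityˡ b)))) (Q≡ H) (K≡ H) (flag≡ H) (no-output H)

module LongDivision (d : ℕ) (σ : Fin 2) where

  record Divided (c r q : ℕ) (s : St) : Set where
    constructor divided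
    field
      r′ q′ : ℕ
      s′ : St
      t : ℕ
      run : Reach 9 s 15 s′ t
      registers : Holds s′ r′ d q′ 0 σ
      r′<d : r′ < d
      invariant : 2 ^ c * (q * d + r) ≡ q′ * d + r′
      time : t ≤ 8 * c + 2

  private
    doubled-step : ∀ c q r → 2 ^ suc c * (q * d + r) ≡ 2 ^ c * ((q + q) * d + (r + r))
    doubled-step c q r = solve 4 (λ x q r d → (con 2 :* x) :* (q :* d :+ r) := x :* ((q :+ q) :* d :+ (r :+ r))) refl (2 ^ c) q r d
      where open ℕ-Solver

    subtracted-step : ∀ q r′ r → r′ + d ≡ r + r → (q + q) * d + (r + r) ≡ (q + q + 1) * d + r′
    subtracted-step q r′ r r′+d≡2r = trans (cong (λ x → (q + q) * d + x) (sym r′+d≡2r))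
      (solve 3 (λ q r′ d → (q :+ q) :* d :+ (r′ :+ d) := (q :+ q :+ con 1) :* d :+ r′) refl q r′ d)
      where open ℕ-Solver

    round-time : ∀ u c t → u ≤ 8 → t ≤ 8 * c + 2 → u + t ≤ 8 * suc c + 2
    round-time u c t u≤8 t≤ = ℕP.≤-trans (ℕP.+-mono-≤ u≤8 t≤)
      (ℕP.≤-reflexive (solve 1 (λ c → con 8 :+ (con 8 :* c :+ con 2) := con 8 :* (con 1 :+ c) :+ con 2) refl c))
      where open ℕ-Solver

  loop : ∀ c r q s → Holds s r d q c σ → r < d → Divided c r q s
  loop zero r q s H r<d =
    divided r q s 2 (step-if refl refl (K=0-test H) refl done) H r<d (ℕP.*-identityˡ _) (ℕP.m≤n+m 2 0)
  loop (suc c) r q s H r<d with (r + r) <? d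
  ... | yes 2r<d = prepend (loop c (r + r) (q + q) s′ H′ 2r<d)
    where
    s′ : St
    s′ = setReg (setReg (setReg s K (regs s K ℤ.- + 1)) R (regs s R ℤ.+ regs s R)) Q (regs s Q ℤ.+ regs s Q)
    H′ : Holds s′ (r + r) d (q + q) c σ
    H′ = holding (cong₂ ℤ._+_ (R≡ H) (R≡ H)) (D≡ H) (cong₂ ℤ._+_ (Q≡ H) (Q≡ H)) (cong (ℤ._- + 1) (K≡ H))
                 (flag≡ H) (no-output H)
    prepend : Divided c (r + r) (q + q) s′ → Divided (suc c) r q s
    prepend (divided r″ q″ s″ t run H″ r″<d inv time) =
      divided r″ q″ s″ (2 + (1 + (1 + (2 + t))))
        (step-if refl refl (K=0-test H) refl (step refl refl (step refl refl
          (step-if refl refl (trans (R+R<D-test H) (dec-true ((r + r) <? d) 2r<d)) refl run))))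
        H″ r″<d (trans (doubled-step c q r) inv) (round-time 6 c t (ℕP.m≤m+n 6 2) time)
  ... | no 2r≮d = prepend (loop c r′ (q + q + 1) s′ H′ r′<d)
    where
    d≤2r : d ≤ r + r
    d≤2r = ℕP.≮⇒≥ 2r≮d
    r′ = r + r ∸ d
    r′<d : r′ < d
    r′<d = ℕP.+-cancelʳ-< d r′ d (subst (_< d + d) (sym (ℕP.m∸n+n≡m d≤2r)) (ℕP.+-mono-< r<d r<d))
    s′ : St
    s′ = setReg (setReg (setReg (setReg (setReg s K (regs s K ℤ.- + 1)) R (regs s R ℤ.+ regs s R)) Q (regs s Q ℤ.+ regs s Q))
           R ((regs s R ℤ.+ regs s R) ℤ.- regs s D)) Q (regs s Q ℤ.+ regs s Q ℤ.+ + 1)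
    H′ : Holds s′ r′ d (q + q + 1) c σ
    H′ = holding (trans (cong₂ ℤ._-_ (cong₂ ℤ._+_ (R≡ H) (R≡ H)) (D≡ H)) (trans (ℤP.[+m]-[+n]≡m⊖n (r + r) d) (ℤP.⊖-≥ d≤2r)))
                 (D≡ H) (cong (ℤ._+ + 1) (cong₂ ℤ._+_ (Q≡ H) (Q≡ H))) (cong (ℤ._- + 1) (K≡ H)) (flag≡ H) (no-output H)
    prepend : Divided c r′ (q + q + 1) s′ → Divided (suc c) r q s
    prepend (divided r″ q″ s″ t run H″ r″<d inv time) =
      divided r″ q″ s″ (2 + (1 + (1 + (2 + (1 + (1 + t))))))
        (step-if refl refl (K=0-test H) refl (step refl refl (step refl refl
          (step-if refl refl (trans (R+R<D-test H) (dec-false ((r + r) <? d) 2r≮d)) refl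
            (step refl refl (step refl refl run))))))
        H″ r″<d
        (trans (doubled-step c q r) (trans (cong (2 ^ c *_) (subtracted-step q r′ r (ℕP.m∸n+n≡m d≤2r))) inv))
        (round-time 8 c t ℕP.≤-refl time)

result : Fin 2 → ℕ → ℕ → ℤ
result zero r q = + q
result (suc zero) zero q = + 0 ℤ.- + q
result (suc zero) (suc _) q = + 0 ℤ.- + (q + 1)

write-Q : ∀ (s : St) v → regs s Q ≡ v → output s ≡ [] → Runs divider 18 s 1 (v ∷ [])
write-Q s v Q≡v no-out =
  subst (Runs divider 18 s 1) (cong₂ _++_ no-out (cong (_∷ []) Q≡v)) (step refl refl (halt refl))

correct-sign : ∀ r d q σ s → Holds s r d q 0 σ → Σ ℕ λ t → Runs divider 15 s t (result σ r q ∷ []) × t ≤ 6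
correct-sign r d q zero s H =
  _ , runs-after (step-if refl refl (flag-test H) refl done)
        (write-Q _ _ (Q≡ H) (no-output H)) ,
  ℕP.m≤m+n 3 3
correct-sign zero d q (suc zero) s H = _ , runs-after
  (step-if refl refl (flag-test H) refl
    (step-if refl refl (R=0-test H) refl (step refl refl done)))
  (write-Q _ _ (cong (λ v → + 0 ℤ.- v) (Q≡ H)) (no-output H)) , ℕP.≤-refl
correct-sign (suc r) d q (suc zero) s H = _ , runs-after
  (step-if refl refl (flag-test H) refl
    (step-if refl refl (R=0-test H) refl (step refl refl done)))
  (write-Q _ _ (cong (λ v → + 0 ℤ.- (v ℤ.+ + 1)) (Q≡ H)) (no-output H)) , ℕP.≤-refl

result-floor : ∀ σ n q s r c .{{_ : ℕ.NonZero c}} → s < suc n → r ≡ c * s →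
               result σ r q ≡ floor (signed σ (q * suc n + s) ℚ./ suc n)
result-floor zero n q s r c s<b _ = sym (floor-+-divMod n q s s<b)
result-floor (suc zero) n q zero zero c _ _ =
  trans (ℤP.+-identityˡ (ℤ.- + q)) (sym (floor-neg-divMod-0 n q))
result-floor (suc zero) n q (suc s) (suc r) c s<b _ =
  trans (ℤP.+-identityˡ (ℤ.- + (q + 1))) (sym (floor-neg-divMod-suc n q s s<b))
result-floor (suc zero) n q zero (suc r) c _ r≡c*0 with trans r≡c*0 (ℕP.*-zeroʳ c)
... | ()
result-floor (suc zero) n q (suc s) zero c _ 0≡c*[1+s] =
  contradiction (ℕP.m*n≡0⇒m≡0 c (suc s) (sym 0≡c*[1+s])) (ℕ.≢-nonZero⁻¹ c)

running-time : ∀ t₀ t₁ t₂ t₃ k m → t₀ ≤ 8 → t₁ ≡ 4 * k + 2 → t₂ ≤ 8 * k + 2 → t₃ ≤ 6 → k ≤ suc m →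
               t₀ + (t₁ + (t₂ + t₃)) ≤ 12 * m + 30
running-time t₀ t₁ t₂ t₃ k m t₀≤ refl t₂≤ t₃≤ k≤1+m = begin
  t₀ + (4 * k + 2 + (t₂ + t₃))             ≤⟨ ℕP.+-mono-≤ t₀≤ (ℕP.+-monoʳ-≤ (4 * k + 2) (ℕP.+-mono-≤ t₂≤ t₃≤)) ⟩
  8 + (4 * k + 2 + (8 * k + 2 + 6))        ≡⟨ solve 1 (λ k → con 8 :+ (con 4 :* k :+ con 2 :+ (con 8 :* k :+ con 2 :+ con 6))
                                                          := con 12 :* k :+ con 18) refl k ⟩
  12 * k + 18                              ≤⟨ ℕP.+-monoˡ-≤ 18 (ℕP.*-monoʳ-≤ 12 k≤1+m) ⟩
  12 * suc m + 18                          ≡⟨ solve 1 (λ m → con 12 :* (con 1 :+ m) :+ con 18 := con 12 :* m :+ con 30) refl m ⟩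
  12 * m + 30                              ∎
  where
  open ℕP.≤-Reasoning
  open ℕ-Solver

divider-correct : (y z : ℤ) → z ≢ + 0 →
                  Σ ℕ λ t → RunsOn divider (y ∷ z ∷ []) t (floorDiv y z ∷ [])
                    × ((m : ℕ) → IsLeastExp y z m → t ≤ 12 * m + 30)
divider-correct y z z≢0 with normalise y z z≢0
... | normalised a n σ s₀ t₀ run₀ H₀ t₀≤8 ∣y∣≡a ∣z∣≡1+n floorDiv≡
  with Doubling.doubling a (suc n) σ z<s s₀ H₀
... | Doubling.doubled k s₁ t₁ run₁ H₁ a<2^kb below t₁≡
  with LongDivision.loop (2 ^ k * suc n) σ k a 0 s₁ H₁ a<2^kb
... | LongDivision.divided r q s₂ t₂ run₂ H₂ r<2^kb quotient t₂≤
  with correct-sign r _ q σ s₂ H₂ | scaled-divMod (2 ^ k) {{ℕP.m^n≢0 2 k}} a (suc n) q r quotient r<2^kb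
... | t₃ , run₃ , t₃≤6 | s , a≡qb+s , s<b , r≡2^ks =
  t₀ + (t₁ + (t₂ + t₃)) ,
  subst (λ v → RunsOn divider (y ∷ z ∷ []) _ (v ∷ [])) result≡floorDiv
    (runs-after run₀ (runs-after run₁ (runs-after run₂ run₃))) ,
  λ m (∣y∣≤2^m∣z∣ , _) → running-time t₀ t₁ t₂ t₃ k m t₀≤8 t₁≡ t₂≤ t₃≤6
    (doublings≤1+m a (suc n) m k z<s (subst₂ (λ u v → u ≤ 2 ^ m * v) ∣y∣≡a ∣z∣≡1+n ∣y∣≤2^m∣z∣) below)
  where
  result≡floorDiv : result σ r q ≡ floorDiv y z
  result≡floorDiv = begin
    result σ r q                                ≡⟨ result-floor σ n q s r (2 ^ k) {{ℕP.m^n≢0 2 k}} s<b r≡2^ks ⟩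
    floor (signed σ (q * suc n + s) ℚ./ suc n)  ≡⟨ cong (λ x → floor (signed σ x ℚ./ suc n)) a≡qb+s ⟨
    floor (signed σ a ℚ./ suc n)                ≡⟨ floorDiv≡ ⟨
    floorDiv y z                                ∎
    where open ≡-Reasoning

theorem5 : Σ ℕ λ nv → Σ ℕ λ b → Σ (Program 4 nv b) λ P → Σ ℕ λ c → Σ ℕ λ d →
    (y z : ℤ) → z ≢ + 0 →
      Σ ℕ λ t → RunsOn P (y ∷ z ∷ []) t (floorDiv y z ∷ [])
        × ((m : ℕ) → IsLeastExp y z m → t ≤ c * m + d)
theorem5 = 1 , 1 , divider , 12 , 30 , divider-correct
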